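{- Let $\mathcal{A}=(A,\to_\mathcal{A})$ be an abstract reduction system, let $P\subseteq A$ and $Q,E\subseteq\mathrm{NF}_\mathcal{A}$, and suppose $P\Rightarrow Q$ is a safety APR predicate for $E$ w.r.t. $\mathcal{A}$. Then $P\Rightarrow Q$ is partially valid w.r.t. $\mathcal{A}$ if and only if there is no finite execution path of $\mathcal{A}$ that starts with an element of $P$ and includes an element of $E$.
   Context: An abstract reduction system is a pair $\mathcal{A}=(A,\to_\mathcal{A})$ of a set $A$ and a binary relation on $A$; $\to_\mathcal{A}^*$ is its reflexive-transitive closure; $\mathrm{NF}_\mathcal{A}$ is the set of normal forms; $\Delta_\mathcal{A}(P)=\{t\mid\exists s\in P.\ s\to_\mathcal{A}t\}$; $P$ is $\mathcal{A}$-runnable if $P\neq\emptyset$ and $P\cap\mathrm{NF}_\mathcal{A}=\emptyset$. An execution path is a maximal reduction sequence $s_0\to_\mathcal{A}s_1\to_\mathcal{A}\cdots$: either finite ending in an element of $\mathrm{NF}_\mathcal{A}$, or infinite. An APR predicate is a pair $P\Rightarrow Q$ with $P,Q\subseteq A$. $P\Rightarrow Q$ is partially valid w.r.t. $\mathcal{A}$ if it lies in the greatest fixed point of the functional (mapping a set $X$ of predicates to the conclusions of rule instances with all premises in $X$ and side conditions true) of the rules (Subsumption) no premises, conclude $P\Rightarrow Q$ if $P\subseteq Q$; (Step) from $\Delta_\mathcal{A}(P\setminus Q)\Rightarrow Q$ conclude $P\Rightarrow Q$ if $P\setminus Q$ is $\mathcal{A}$-runnable. For a set $E\subseteq\mathrm{NF}_\mathcal{A}$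 (of error states), $P\Rightarrow Q$ is a safety APR predicate for $E$ w.r.t. $\mathcal{A}$ if $Q\cap E=\emptyset$, $\{t\in\mathrm{NF}_\mathcal{A}\setminus E\mid\exists s\in P.\ s\to_\mathcal{A}^*t\}\subseteq Q$, and $Q\subseteq\mathrm{NF}_\mathcal{A}$. -}

module Defs where

open import Level using (Level; suc; _⊔_)
open import Data.Nat using (ℕ)
open import Data.Fin using (Fin; inject₁; fromℕ) renaming (suc to fsuc; zero to fzero)
open import Data.Product using (Σ; ∃; ∃-syntax; _×_; _,_)
open import Data.Sum using (_⊎_)
open import Data.Empty using (⊥)
open import Relation.Nullary using (¬_)
open import Relation.Unary using (Pred; _⊆_)
open import Relation.Binary.Construct.Closure.ReflexiveTransitive using (Star)

record ARS (ℓ : Level) : Set (suc ℓ) where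
  field
    Carrier : Set ℓ
    _⟶_     : Carrier → Carrier → Set ℓ

module _ {ℓ : Level} (𝒜 : ARS ℓ) where
  open ARS 𝒜

  _⟶*_ : Carrier → Carrier → Set ℓ
  _⟶*_ = Star _⟶_

  NF : Pred Carrier ℓ
  NF s = ¬ (∃[ t ] (s ⟶ t))

  _∖_ : Pred Carrier ℓ → Pred Carrier ℓ → Pred Carrier ℓ
  (P ∖ Q) s = P s × ¬ Q s

  Δ : Pred Carrier ℓ → Pred Carrier ℓ
  Δ P t = ∃[ s ] (P s × (s ⟶ t))

  Runnable : Pred Carrier ℓ → Set ℓ
  Runnable P = (∃[ s ] P s) × (∀ s → P s → ¬ NF s)

  APRSet : Set (suc ℓ)
  APRSet = Pred Carrier ℓ → Pred Carrier ℓ → Set ℓ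

  -- The functional of the rules (Subsumption) and (Step)
  Φ : APRSet → APRSet
  Φ X P Q = (P ⊆ Q) ⊎ (Runnable (P ∖ Q) × X (Δ (P ∖ Q)) Q)

  -- Greatest fixed point (Knaster–Tarski): union of all post-fixed points
  PartiallyValid : Pred Carrier ℓ → Pred Carrier ℓ → Set (suc ℓ)
  PartiallyValid P Q =
    Σ APRSet λ X → (∀ P' Q' → X P' Q' → Φ X P' Q') × X P Q

  SafetyAPR : Pred Carrier ℓ → Pred Carrier ℓ → Pred Carrier ℓ → Set ℓ
  SafetyAPR E P Q =
    (∀ t → Q t → E t → ⊥)
    × (∀ t → NF t → ¬ E t → (∃[ s ] (P s × (s ⟶* t))) → Q t)
    × (Q ⊆ NF)

  record FinitePath : Set ℓ where
    field
      len   : ℕ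
      state : Fin (ℕ.suc len) → Carrier
      step  : (i : Fin len) → state (inject₁ i) ⟶ state (fsuc i)
      final : NF (state (fromℕ len))

  ErrorPath : Pred Carrier ℓ → Pred Carrier ℓ → Set ℓ
  ErrorPath P E =
    Σ FinitePath λ π → P (FinitePath.state π fzero)
                      × ∃[ i ] E (FinitePath.state π i)

-- A post-fixed point of Φ containing P ⇒ Q is an invariant along reductions: following a path from P,
-- the current state either lies in Q (and, Q consisting of normal forms, the path stops there) or is
-- runnable and passes its successor on to the next predicate. Hence no normal form reachable from P
-- can lie outside Q, in particular none lies in E. Conversely, if no error state is reachable,
-- safety puts every reachable normal form into Q, and the predicates P' ⇒ Q' with P' reachable
-- from P and Q ⊆ Q' form a post-fixed point; excluded middle decides which rule applies.
module Submission where

open import Defs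
open import Level using (Level)
open import Relation.Unary using (Pred; _⊆_)
open import Relation.Nullary using (¬_; yes; no)
open import Function.Bundles using (_⇔_; mk⇔)
open import Axiom.ExcludedMiddle using (ExcludedMiddle)
open import Data.Nat using (ℕ; zero; suc)
open import Data.Fin using (Fin; inject₁; fromℕ) renaming (suc to fsuc; zero to fzero)
open import Data.Product using (∃-syntax; _×_; _,_)
open import Data.Sum using (inj₁; inj₂)
open import Data.Empty using (⊥-elim)
open import Relation.Binary.Construct.Closure.ReflexiveTransitive using (Star; ε; _◅_; _◅◅_)
open import Relation.Binary.PropositionalEquality using (_≡_; refl; subst; sym)

module _ {ℓ : Level} (𝒜 : ARS ℓ) where
  open ARS 𝒜

  Reachable : Pred Carrier ℓ → Pred Carrier ℓ
  Reachable P t = ∃[ s ] (P s × Star _⟶_ s t)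

  chain-prefix : ∀ n (state : Fin (suc n) → Carrier) →
                 (∀ i → state (inject₁ i) ⟶ state (fsuc i)) →
                 ∀ i → Star _⟶_ (state fzero) (state i)
  chain-prefix n       state step fzero    = ε
  chain-prefix (suc n) state step (fsuc i) =
    step fzero ◅ chain-prefix n (λ j → state (fsuc j)) (λ j → step (fsuc j)) i

  finitePath-prefix : (π : FinitePath 𝒜) → ∀ i →
                      Star _⟶_ (FinitePath.state π fzero) (FinitePath.state π i)
  finitePath-prefix π = chain-prefix (FinitePath.len π) (FinitePath.state π) (FinitePath.step π)

  steps : ∀ {s t} → Star _⟶_ s t → ℕ
  steps ε        = zero
  steps (_ ◅ xs) = suc (steps xs)

  states : ∀ {s t} (xs : Star _⟶_ s t) → Fin (suc (steps xs)) → Carrier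
  states {s} xs       fzero    = s
  states     (_ ◅ xs) (fsuc i) = states xs i

  states-step : ∀ {s t} (xs : Star _⟶_ s t) (i : Fin (steps xs)) →
                states xs (inject₁ i) ⟶ states xs (fsuc i)
  states-step (x ◅ xs) fzero    = x
  states-step (x ◅ xs) (fsuc i) = states-step xs i

  states-last : ∀ {s t} (xs : Star _⟶_ s t) → states xs (fromℕ (steps xs)) ≡ t
  states-last ε        = refl
  states-last (_ ◅ xs) = states-last xs

  star⇒finitePath : ∀ {s t} (xs : Star _⟶_ s t) → NF 𝒜 t → FinitePath 𝒜
  star⇒finitePath xs nf = record
    { len   = steps xs
    ; state = states xs
    ; step  = states-step xs
    ; final = subst (NF 𝒜) (sym (states-last xs)) nf
    }

  reachable-error⇒errorPath : ∀ {P E t} → Reachable P t → NF 𝒜 t → E t → ErrorPath 𝒜 P E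
  reachable-error⇒errorPath {E = E} (s , p , xs) nf e =
    star⇒finitePath xs nf , p , fromℕ (steps xs) , subst E (sym (states-last xs)) e

  -- Only ¬ ¬ Q t, as deciding Q t would need excluded middle; this suffices to rule out E t.
  postFixed-sound : ∀ {Q} → Q ⊆ NF 𝒜 → (X : APRSet 𝒜) → (∀ P Q → X P Q → Φ 𝒜 X P Q) →
                    ∀ {P s t} → X P Q → P s → Star _⟶_ s t → NF 𝒜 t → ¬ ¬ Q t
  postFixed-sound Q⊆NF X post {P} x p xs nf ¬q with post P _ x | xs
  ... | inj₁ P⊆Q               | ε      = ¬q (P⊆Q p)
  ... | inj₁ P⊆Q               | r ◅ _  = Q⊆NF (P⊆Q p) (_ , r)
  ... | inj₂ ((_ , stuck) , _) | ε      = stuck _ (p , ¬q) nf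
  ... | inj₂ (_ , x′)          | r ◅ rs =
    postFixed-sound Q⊆NF X post x′ (_ , (p , λ q → Q⊆NF q (_ , r)) , r) rs nf ¬q

  partiallyValid-sound : ∀ {P Q t} → Q ⊆ NF 𝒜 → PartiallyValid 𝒜 P Q →
                         Reachable P t → NF 𝒜 t → ¬ ¬ Q t
  partiallyValid-sound Q⊆NF (X , post , x) (_ , p , xs) = postFixed-sound Q⊆NF X post x p xs

  partiallyValid-complete : ExcludedMiddle ℓ → ∀ {P Q} →
                            (∀ t → NF 𝒜 t → Reachable P t → Q t) → PartiallyValid 𝒜 P Q
  partiallyValid-complete em {P} {Q} reachNF⊆Q = X , post , ((λ p → _ , p , ε) , λ q → q)
    where
    X : APRSet 𝒜
    X P′ Q′ = (P′ ⊆ Reachable P) × (Q ⊆ Q′)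

    post : ∀ P′ Q′ → X P′ Q′ → Φ 𝒜 X P′ Q′
    post P′ Q′ (P′⊆R , Q⊆Q′) with em {∃[ s ] _∖_ 𝒜 P′ Q′ s}
    ... | yes nonempty = inj₂ ((nonempty , stuck) , Δ⊆R , Q⊆Q′)
      where
      stuck : ∀ s → _∖_ 𝒜 P′ Q′ s → ¬ NF 𝒜 s
      stuck s (p , ¬q) nf = ¬q (Q⊆Q′ (reachNF⊆Q s nf (P′⊆R p)))

      Δ⊆R : Δ 𝒜 (_∖_ 𝒜 P′ Q′) ⊆ Reachable P
      Δ⊆R (_ , (p , _) , r) with P′⊆R p
      ... | s₀ , p₀ , xs = s₀ , p₀ , xs ◅◅ (r ◅ ε)
    ... | no empty = inj₁ P′⊆Q′
      where
      P′⊆Q′ : P′ ⊆ Q′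
      P′⊆Q′ {s} p with em {Q′ s}
      ... | yes q  = q
      ... | no ¬q = ⊥-elim (empty (s , p , ¬q))

theorem23 : {ℓ : Level} → ExcludedMiddle ℓ → (𝒜 : ARS ℓ) →
    (P Q E : Pred (ARS.Carrier 𝒜) ℓ) →
    Q ⊆ NF 𝒜 → E ⊆ NF 𝒜 →
    SafetyAPR 𝒜 E P Q →
    PartiallyValid 𝒜 P Q ⇔ (¬ ErrorPath 𝒜 P E)
theorem23 em 𝒜 P Q E Q⊆NF E⊆NF (Q∩E=∅ , safeNF⊆Q , _) = mk⇔ noErrorPath reachNF⊆Q⇒valid
  where
  noErrorPath : PartiallyValid 𝒜 P Q → ¬ ErrorPath 𝒜 P E
  noErrorPath valid (π , p , i , e) =
    partiallyValid-sound 𝒜 Q⊆NF valid (_ , p , finitePath-prefix 𝒜 π i) (E⊆NF e)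
      (λ q → Q∩E=∅ _ q e)

  reachNF⊆Q⇒valid : ¬ ErrorPath 𝒜 P E → PartiallyValid 𝒜 P Q
  reachNF⊆Q⇒valid noError = partiallyValid-complete 𝒜 em reachNF⊆Q
    where
    reachNF⊆Q : ∀ t → NF 𝒜 t → Reachable 𝒜 P t → Q t
    reachNF⊆Q t nf reach with em {E t}
    ... | yes e  = ⊥-elim (noError (reachable-error⇒errorPath 𝒜 reach nf e))
    ... | no ¬e = safeNF⊆Q t nf ¬e reach
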